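{- There is a function $\mathrm{Nrm}:\omega^2\rightarrow\omega$ such that the following holds. Suppose $\chi:[\omega]^2\rightarrow\omega$ is a $2$-bounded coloring, $X\subseteq\omega$ is a finite set normal for $\chi$ with $|X|=p$, and $Z\subseteq\omega$ with $\max(X)<\min(Z)$ and $|Z|\geq\mathrm{Nrm}(p,n)$. Then there is $Y\subseteq Z$ with $|Y|\geq n$ such that $X\cup Y$ is normal for $\chi$.
   Context: A coloring $\chi:[\omega]^2\rightarrow\omega$ is $2$-bounded if each color is assigned to at most two pairs; write $\chi(a,b)$ for $\chi(\{a,b\})$. A set $A\subseteq\omega$ is normal (for $\chi$) if whenever $a_0<a_1$ and $b_0<b_1$ are in $A$ with $\chi(a_0,a_1)=\chi(b_0,b_1)$, then $a_1=b_1$. -}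

module Defs where

open import Data.Nat using (ℕ; _<_)
open import Data.Product using (_×_; Σ; ∃)
open import Data.Sum using (_⊎_)
open import Data.List using (List; length)
open import Data.List.Relation.Unary.All using (All)
open import Data.List.Relation.Unary.Unique.Propositional using (Unique)
open import Relation.Binary.PropositionalEquality using (_≡_)

-- A coloring χ : [ω]² → ω is given as a function ℕ → ℕ → ℕ where
-- χ a b (for a < b) is the colour of the pair {a,b}; values with a ≥ b are irrelevant.
Coloring : Set
Coloring = ℕ → ℕ → ℕ

Subset : Set₁
Subset = ℕ → Set

SamePair : ℕ → ℕ → ℕ → ℕ → Set
SamePair a0 a1 b0 b1 = (a0 ≡ b0) × (a1 ≡ b1)

-- 2-bounded: each colour is assigned to at most two pairs, i.e. among any
-- three pairs of the same colour, two coincide.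
TwoBounded : Coloring → Set
TwoBounded χ =
  ∀ a0 a1 b0 b1 c0 c1 →
  a0 < a1 → b0 < b1 → c0 < c1 →
  χ a0 a1 ≡ χ b0 b1 → χ a0 a1 ≡ χ c0 c1 →
  SamePair a0 a1 b0 b1 ⊎ (SamePair a0 a1 c0 c1 ⊎ SamePair b0 b1 c0 c1)

Normal : Coloring → Subset → Set
Normal χ A =
  ∀ a0 a1 b0 b1 → A a0 → A a1 → A b0 → A b1 →
  a0 < a1 → b0 < b1 → χ a0 a1 ≡ χ b0 b1 → a1 ≡ b1

AtLeast : Subset → ℕ → Set
AtLeast A N = Σ (List ℕ) λ zs → Unique zs × length zs ≡ N × All A zs

_⊆_ : Subset → Subset → Set
Y ⊆ Z = ∀ a → Y a → Z a

_∪_ : Subset → Subset → Subset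
(X ∪ Y) a = X a ⊎ Y a

module Submission where

-- Let S be a finite normal set, k = |S|, and W a set of candidates lying above S.
-- Adding z ∈ W to S keeps it normal unless some triple (a , b , s) ∈ S³ with a < b
-- obstructs z, i.e. χ(s,z) = χ(a,b): a new pair {s,z} has top z, so the only possible
-- clash is with an old pair {a,b}.  Since χ is 2-bounded and {a,b} is not of the
-- form {s,z}, each triple obstructs at most one candidate.  Removing the obstructed
-- candidates therefore costs at most k³ elements; we add the least survivor z to S,
-- discard z from the survivors (so the rest lies above S ∪ {z}) and repeat with
-- k + 1 in place of k.  This gives the bound
--   Nrm k 0 = 0,   Nrm k (n + 1) = k³ + 1 + Nrm (k + 1) n.

open import Defs
open import Data.Nat using (ℕ; _<_)
open import Data.Product using (_×_; Σ)
open import Data.List using (List; length)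
open import Data.List.Membership.Propositional using (_∈_)
open import Data.List.Relation.Unary.Unique.Propositional using (Unique)
open import Relation.Binary.PropositionalEquality using (_≡_)

open import Function using (_∘_; id)
open import Data.Nat using (zero; suc; _+_; _*_; _≤_; z≤n; s≤s; s≤s⁻¹; _<?_; _≟_)
open import Data.Nat.Properties
  using (≤-reflexive; ≤-trans; ≤-antisym; <-irrefl; <-asym;
         +-cancelˡ-≤; +-cancelʳ-<; ≮⇒≥; <⇒≢; m<m+n; +-suc; +-comm; +-monoˡ-≤; +-identityʳ)
open import Data.Product using (_,_; proj₁; proj₂)
open import Data.Sum using (inj₁; inj₂)
open import Data.Empty using (⊥-elim)
open import Data.List using ([]; _∷_; map; _++_; filter; cartesianProduct)
open import Data.List.Properties using (length-++; length-map; filter-all)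
open import Data.List.Extrema.Nat using (min; min≤⊤; min≤xs; argmin-sel)
open import Data.List.Relation.Unary.All as All using (All; []; _∷_)
open import Data.List.Relation.Unary.Any using (here; there)
open import Data.List.Relation.Unary.AllPairs using ([]; _∷_)
open import Data.List.Relation.Unary.Unique.Propositional.Properties using (filter⁺)
open import Data.List.Membership.Propositional.Properties
  using (∈-filter⁻; ∈-cartesianProduct⁺; ∈-cartesianProduct⁻)
open import Relation.Nullary using (¬_; Dec; yes; no; ¬?)
open import Relation.Nullary.Decidable using (decidable-stable; _×-dec_)
open import Relation.Unary using (Decidable)
open import Relation.Binary.PropositionalEquality using (_≢_; refl; sym; trans; cong; subst; module ≡-Reasoning)

AtMostOne : {A : Set} → (A → Set) → List A → Set
AtMostOne P ws = ∀ {x y} → x ∈ ws → y ∈ ws → P x → P y → x ≡ y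

length-filter-≥ : {A : Set} {P : A → Set} (P? : Decidable P) (ws : List A) →
  Unique ws → AtMostOne (¬_ ∘ P) ws → length ws ≤ suc (length (filter P? ws))
length-filter-≥ P? [] _ _ = z≤n
length-filter-≥ {P = P} P? (w ∷ ws) (w∉ws ∷ unique) one with P? w
... | yes _ = s≤s (length-filter-≥ P? ws unique λ x∈ y∈ → one (there x∈) (there y∈))
... | no ¬Pw = s≤s (≤-reflexive (sym (cong length (filter-all P? (All.tabulate P-on-ws)))))
  where
    -- every element of ws satisfies P, because the only failure is w ∉ ws
    P-on-ws : ∀ {y} → y ∈ ws → P y
    P-on-ws {y} y∈ws = decidable-stable (P? y) λ ¬Py →
      All.lookup w∉ws y∈ws (one (here refl) (there y∈ws) ¬Pw ¬Py)

module Sieve {F A : Set} (Forbids : F → A → Set) (forbids? : ∀ t a → Dec (Forbids t a)) where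

  sieve : List F → List A → List A
  sieve [] ws = ws
  sieve (t ∷ ts) ws = filter (¬? ∘ forbids? t) (sieve ts ws)

  sieve-⊆ : ∀ ts {ws a} → a ∈ sieve ts ws → a ∈ ws
  sieve-⊆ [] a∈ = a∈
  sieve-⊆ (t ∷ ts) {ws} a∈ = sieve-⊆ ts (proj₁ (∈-filter⁻ (¬? ∘ forbids? t) {xs = sieve ts ws} a∈))

  sieve-unique : ∀ ts {ws} → Unique ws → Unique (sieve ts ws)
  sieve-unique [] u = u
  sieve-unique (t ∷ ts) u = filter⁺ (¬? ∘ forbids? t) (sieve-unique ts u)

  sieve-allowed : ∀ ts {ws a} → a ∈ sieve ts ws → ∀ {t} → t ∈ ts → ¬ Forbids t a
  sieve-allowed (t ∷ ts) {ws} a∈ (here refl) = proj₂ (∈-filter⁻ (¬? ∘ forbids? t) {xs = sieve ts ws} a∈)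
  sieve-allowed (t ∷ ts) {ws} a∈ (there t∈) =
    sieve-allowed ts (proj₁ (∈-filter⁻ (¬? ∘ forbids? t) {xs = sieve ts ws} a∈)) t∈

  sieve-length : ∀ ts ws → Unique ws → (∀ {t} → t ∈ ts → AtMostOne (Forbids t) ws) →
    length ws ≤ length (sieve ts ws) + length ts
  sieve-length [] ws _ _ = ≤-reflexive (sym (+-identityʳ (length ws)))
  sieve-length (t ∷ ts) ws u one = begin
    length ws                                    ≤⟨ sieve-length ts ws u (one ∘ there) ⟩
    length rest + length ts                      ≤⟨ +-monoˡ-≤ (length ts) filter-bound ⟩
    suc (length (filter allowed? rest)) + length ts ≡⟨ sym (+-suc _ (length ts)) ⟩
    length (filter allowed? rest) + suc (length ts) ∎
    where
      open Data.Nat.Properties.≤-Reasoning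
      rest : List A
      rest = sieve ts ws
      allowed? : Decidable (λ a → ¬ Forbids t a)
      allowed? = ¬? ∘ forbids? t
      filter-bound : length rest ≤ suc (length (filter allowed? rest))
      filter-bound = length-filter-≥ allowed? rest (sieve-unique ts u)
        λ x∈ y∈ ¬¬x ¬¬y → one (here refl) (sieve-⊆ ts x∈) (sieve-⊆ ts y∈)
          (decidable-stable (forbids? t _) ¬¬x) (decidable-stable (forbids? t _) ¬¬y)

length-cartesianProduct : {A B : Set} (xs : List A) (ys : List B) →
  length (cartesianProduct xs ys) ≡ length xs * length ys
length-cartesianProduct [] ys = refl
length-cartesianProduct (x ∷ xs) ys = begin
  length (map (x ,_) ys ++ cartesianProduct xs ys)       ≡⟨ length-++ (map (x ,_) ys) ⟩
  length (map (x ,_) ys) + length (cartesianProduct xs ys) ≡⟨ cong (_+ _) (length-map (x ,_) ys) ⟩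
  length ys + length (cartesianProduct xs ys)             ≡⟨ cong (length ys +_) (length-cartesianProduct xs ys) ⟩
  length ys + length xs * length ys                      ∎
  where open ≡-Reasoning

least : (ws : List ℕ) → 0 < length ws → Σ ℕ λ m → m ∈ ws × All (m ≤_) ws
least (w ∷ ws) _ = min w ws , min∈ , min≤⊤ w ws ∷ min≤xs w ws
  where
    min∈ : min w ws ∈ w ∷ ws
    min∈ with argmin-sel id w ws
    ... | inj₁ eq = here eq
    ... | inj₂ m∈ = there m∈

normal-⊆ : (χ : Coloring) {A B : Subset} → A ⊆ B → Normal χ B → Normal χ A
normal-⊆ χ A⊆B normal a0 a1 b0 b1 a0∈ a1∈ b0∈ b1∈ =
  normal a0 a1 b0 b1 (A⊆B a0 a0∈) (A⊆B a1 a1∈) (A⊆B b0 b0∈) (A⊆B b1 b1∈)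

Above : List ℕ → ℕ → Set
Above S z = ∀ x → x ∈ S → x < z

Triple : Set
Triple = ℕ × ℕ × ℕ

-- The triple (a , b , s) obstructs adding z on top of a set containing a, b, s:
-- the new pair {s,z} would have the colour of the old pair {a,b}.
Obstructs : Coloring → Triple → ℕ → Set
Obstructs χ (a , b , s) z = a < b × χ s z ≡ χ a b

obstructs? : (χ : Coloring) → ∀ t z → Dec (Obstructs χ t z)
obstructs? χ (a , b , s) z = (a <? b) ×-dec (χ s z ≟ χ a b)

-- A normal set S stays normal when an element z above it is added that no triple
-- from S obstructs: two pairs with equal colour either both have top z, or both
-- lie in S, or one is {s,z} and the other some {a,b} ⊆ S, which is excluded.
normal-extend : (χ : Coloring) (S : List ℕ) (z : ℕ) → Normal χ (_∈ S) → Above S z →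
  (∀ {a b s} → a ∈ S → b ∈ S → s ∈ S → ¬ Obstructs χ (a , b , s) z) →
  Normal χ (_∈ z ∷ S)
normal-extend χ S z normal z-above unobstructed a0 a1 b0 b1 a0∈ a1∈ b0∈ b1∈ a0<a1 b0<b1 same =
  tops a0∈ a1∈ b0∈ b1∈ a0<a1 b0<b1 same
  where
    below-S : ∀ {u v} → u ∈ z ∷ S → v ∈ S → u < v → u ∈ S
    below-S (here refl) v∈ u<v = ⊥-elim (<-asym u<v (z-above _ v∈))
    below-S (there u∈) _ _ = u∈
    below-z : ∀ {u} → u ∈ z ∷ S → u < z → u ∈ S
    below-z (here refl) u<z = ⊥-elim (<-irrefl refl u<z)
    below-z (there u∈) _ = u∈
    tops : ∀ {a0 a1 b0 b1} → a0 ∈ z ∷ S → a1 ∈ z ∷ S → b0 ∈ z ∷ S → b1 ∈ z ∷ S →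
      a0 < a1 → b0 < b1 → χ a0 a1 ≡ χ b0 b1 → a1 ≡ b1
    tops _ (here refl) _ (here refl) _ _ _ = refl
    tops a0∈ (here refl) b0∈ (there b1∈) a0<z b0<b1 same =
      ⊥-elim (unobstructed (below-S b0∈ b1∈ b0<b1) b1∈ (below-z a0∈ a0<z) (b0<b1 , same))
    tops a0∈ (there a1∈) b0∈ (here refl) a0<a1 b0<z same =
      ⊥-elim (unobstructed (below-S a0∈ a1∈ a0<a1) a1∈ (below-z b0∈ b0<z) (a0<a1 , sym same))
    tops a0∈ (there a1∈) b0∈ (there b1∈) a0<a1 b0<b1 same =
      normal _ _ _ _ (below-S a0∈ a1∈ a0<a1) a1∈ (below-S b0∈ b1∈ b0<b1) b1∈ a0<a1 b0<b1 same

-- For a 2-bounded coloring a triple obstructs at most one z above b and s: the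
-- pairs {a,b}, {s,x}, {s,y} share a colour and {a,b} differs from both others.
obstruction-unique : (χ : Coloring) → TwoBounded χ → ∀ {a b s x y} →
  b < x → s < x → b < y → s < y →
  Obstructs χ (a , b , s) x → Obstructs χ (a , b , s) y → x ≡ y
obstruction-unique χ twoBounded {a} {b} {s} {x} {y} b<x s<x b<y s<y (a<b , χsx) (_ , χsy)
  with twoBounded a b s x s y a<b s<x s<y (sym χsx) (sym χsy)
... | inj₁ (_ , b≡x) = ⊥-elim (<-irrefl b≡x b<x)
... | inj₂ (inj₁ (_ , b≡y)) = ⊥-elim (<-irrefl b≡y b<y)
... | inj₂ (inj₂ (_ , x≡y)) = x≡y

-- cube k = k³, the number of triples from a k-element set.
cube : ℕ → ℕ
cube k = k * (k * k)

Nrm : ℕ → ℕ → ℕ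
Nrm k zero = 0
Nrm k (suc n) = cube k + suc (Nrm (suc k) n)

triples : List ℕ → List Triple
triples S = cartesianProduct S (cartesianProduct S S)

length-triples : ∀ S → length (triples S) ≡ cube (length S)
length-triples S = trans (length-cartesianProduct S (cartesianProduct S S))
  (cong (length S *_) (length-cartesianProduct S S))

module Extension (χ : Coloring) (twoBounded : TwoBounded χ) where

  record Step (S W : List ℕ) : Set where
    field
      next : ℕ
      next∈W : next ∈ W
      next-normal : Normal χ (_∈ next ∷ S)
      rest : List ℕ
      rest⊆W : ∀ {w} → w ∈ rest → w ∈ W
      rest-unique : Unique rest
      rest-above : All (Above (next ∷ S)) rest
      rest-large : length W ≤ cube (length S) + suc (length rest)

  open Sieve (Obstructs χ) (obstructs? χ)

  unobstructed-large : ∀ S W → Unique W → All (Above S) W →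
    length W ≤ length (sieve (triples S) W) + cube (length S)
  unobstructed-large S W unique above =
    subst (length W ≤_) (cong (length (sieve (triples S) W) +_) (length-triples S))
      (sieve-length (triples S) W unique at-most-one)
    where
      at-most-one : ∀ {t} → t ∈ triples S → AtMostOne (Obstructs χ t) W
      at-most-one {a , b , s} t∈ x∈ y∈ =
        let b∈ , s∈ = ∈-cartesianProduct⁻ S S (proj₂ (∈-cartesianProduct⁻ S (cartesianProduct S S) t∈))
        in obstruction-unique χ twoBounded
             (All.lookup above x∈ b b∈) (All.lookup above x∈ s s∈)
             (All.lookup above y∈ b b∈) (All.lookup above y∈ s s∈)

  step : ∀ S W → Normal χ (_∈ S) → Unique W → All (Above S) W →
    cube (length S) < length W → Step S W
  step S W normal unique above W-large = record
    { next = z ; next∈W = sieve-⊆ T z∈ ; next-normal = z-normal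
    ; rest = filter (z <?_) W₁ ; rest⊆W = sieve-⊆ T ∘ proj₁ ∘ ∈-filter⁻ (z <?_) {xs = W₁}
    ; rest-unique = filter⁺ (z <?_) (sieve-unique T unique)
    ; rest-above = All.tabulate rest-above ; rest-large = rest-large }
    where
      T : List Triple
      T = triples S
      W₁ : List ℕ
      W₁ = sieve T W
      W₁-large : length W ≤ length W₁ + cube (length S)
      W₁-large = unobstructed-large S W unique above
      W₁-nonempty : 0 < length W₁
      W₁-nonempty = +-cancelʳ-< (cube (length S)) 0 (length W₁) (≤-trans W-large W₁-large)
      z : ℕ
      z = proj₁ (least W₁ W₁-nonempty)
      z∈ : z ∈ W₁
      z∈ = proj₁ (proj₂ (least W₁ W₁-nonempty))
      z-least : All (z ≤_) W₁
      z-least = proj₂ (proj₂ (least W₁ W₁-nonempty))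
      z-normal : Normal χ (_∈ z ∷ S)
      z-normal = normal-extend χ S z normal (All.lookup above (sieve-⊆ T z∈))
        λ a∈ b∈ s∈ → sieve-allowed T z∈ (∈-cartesianProduct⁺ a∈ (∈-cartesianProduct⁺ b∈ s∈))
      rest-above : ∀ {w} → w ∈ filter (z <?_) W₁ → Above (z ∷ S) w
      rest-above w∈ x (here refl) = proj₂ (∈-filter⁻ (z <?_) {xs = W₁} w∈)
      rest-above w∈ x (there x∈) =
        All.lookup above (sieve-⊆ T (proj₁ (∈-filter⁻ (z <?_) {xs = W₁} w∈))) x x∈
      only-z : AtMostOne (λ w → ¬ z < w) W₁
      only-z x∈ y∈ z≮x z≮y = trans (≤-antisym (≮⇒≥ z≮x) (All.lookup z-least x∈))
                                   (sym (≤-antisym (≮⇒≥ z≮y) (All.lookup z-least y∈)))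
      rest-large : length W ≤ cube (length S) + suc (length (filter (z <?_) W₁))
      rest-large = begin
        length W                       ≤⟨ W₁-large ⟩
        length W₁ + cube (length S)    ≤⟨ +-monoˡ-≤ (cube (length S))
                                            (length-filter-≥ (z <?_) W₁ (sieve-unique T unique) only-z) ⟩
        suc (length (filter (z <?_) W₁)) + cube (length S) ≡⟨ +-comm _ (cube (length S)) ⟩
        cube (length S) + suc (length (filter (z <?_) W₁)) ∎
        where open Data.Nat.Properties.≤-Reasoning

  record Extension (S W : List ℕ) (n : ℕ) : Set where
    field
      ys : List ℕ
      ys-unique : Unique ys
      ys-length : length ys ≡ n
      ys⊆W : All (_∈ W) ys
      ys-normal : Normal χ ((_∈ S) ∪ (_∈ ys))

  extend : ∀ n S → Normal χ (_∈ S) → ∀ W → Unique W → All (Above S) W →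
    Nrm (length S) n ≤ length W → Extension S W n
  extend zero S normal W _ _ _ = record
    { ys = [] ; ys-unique = [] ; ys-length = refl ; ys⊆W = []
    ; ys-normal = normal-⊆ χ (λ { a (inj₁ a∈) → a∈ }) normal }
  extend (suc n) S normal W unique above W-large = record
    { ys = next ∷ ys ; ys-unique = All.tabulate next∉ys ∷ ys-unique
    ; ys-length = cong suc ys-length ; ys⊆W = next∈W ∷ All.map rest⊆W ys⊆W
    ; ys-normal = normal-⊆ χ regroup ys-normal }
    where
      k : ℕ
      k = length S
      open Step (step S W normal unique above
                  (≤-trans (m<m+n (cube k) (s≤s z≤n)) W-large))
      open Extension (extend n (next ∷ S) next-normal rest rest-unique rest-above
                       (s≤s⁻¹ (+-cancelˡ-≤ (cube k) _ _ (≤-trans W-large rest-large))))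
      next∉ys : ∀ {y} → y ∈ ys → next ≢ y
      next∉ys y∈ = <⇒≢ (All.lookup rest-above (All.lookup ys⊆W y∈) next (here refl))
      regroup : ((_∈ S) ∪ (_∈ next ∷ ys)) ⊆ ((_∈ next ∷ S) ∪ (_∈ ys))
      regroup a (inj₁ a∈S) = inj₁ (there a∈S)
      regroup a (inj₂ (here refl)) = inj₁ (here refl)
      regroup a (inj₂ (there a∈ys)) = inj₂ a∈ys

mainTheorem18 : Σ (ℕ → ℕ → ℕ) λ Nrm →
    (χ : Coloring) → TwoBounded χ →
    (p n : ℕ) (xs : List ℕ) → Unique xs → length xs ≡ p →
    Normal χ (λ a → a ∈ xs) →
    (Z : Subset) → (∀ x z → x ∈ xs → Z z → x < z) →
    AtLeast Z (Nrm p n) →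
    Σ Subset λ Y → (Y ⊆ Z) × AtLeast Y n × Normal χ ((λ a → a ∈ xs) ∪ Y)
mainTheorem18 = Nrm , λ where
  χ twoBounded p n xs _ refl normal Z Z-above (zs , zs-unique , zs-length , zs∈Z) →
    let open Extension χ twoBounded
        e : Extension xs zs n
        e = extend n xs normal zs zs-unique
              (All.map (λ Zz x x∈ → Z-above x _ x∈ Zz) zs∈Z) (≤-reflexive (sym zs-length))
        open Extension.Extension e
    in (_∈ ys) , (λ y y∈ → All.lookup zs∈Z (All.lookup ys⊆W y∈)) ,
       (ys , ys-unique , ys-length , All.tabulate id) , ys-normal
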